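{- Let $n=p^{\alpha}$ with $p$ prime and $\alpha\ge3$. Then the automorphism group of $\Upsilon_n$ has order $2$.
   Context: For an integer $n>1$, a proper divisor of $n$ is an integer $d$ with $1<d<n$ and $d\mid n$. The proper divisor graph $\Upsilon_n$ is the simple graph whose vertices are the proper divisors of $n$, two distinct vertices $u,v$ being adjacent iff $n\mid uv$. -}

module Defs where

open import Data.Nat using (ℕ; _*_; _<_)
open import Data.Nat.Divisibility using (_∣_)
open import Data.Product using (Σ; _×_; proj₁)
open import Relation.Nullary using (¬_)
open import Relation.Binary.PropositionalEquality using (_≡_)
open import Function.Bundles using (_⇔_)
open import Function.Definitions using (Bijective)
open import Data.Sum using (_⊎_)

ProperDivisor : ℕ → ℕ → Set
ProperDivisor n d = 1 < d × d < n × d ∣ n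

-- vertices of Υ_n : the proper divisors of n
Vertex : ℕ → Set
Vertex n = Σ ℕ (ProperDivisor n)

_≈V_ : ∀ {n} → Vertex n → Vertex n → Set
u ≈V v = proj₁ u ≡ proj₁ v

-- adjacency in the simple graph Υ_n : distinct and n ∣ uv
Adjacent : (n : ℕ) → Vertex n → Vertex n → Set
Adjacent n u v = ¬ (proj₁ u ≡ proj₁ v) × n ∣ (proj₁ u * proj₁ v)

record IsAutomorphism (n : ℕ) (f : Vertex n → Vertex n) : Set where
  field
    cong      : ∀ {u v} → u ≈V v → f u ≈V f v
    bijective : Bijective (_≈V_ {n}) (_≈V_ {n}) f
    adjacency : ∀ u v → Adjacent n u v ⇔ Adjacent n (f u) (f v)

Automorphism : ℕ → Set
Automorphism n = Σ (Vertex n → Vertex n) (IsAutomorphism n)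

_≈A_ : ∀ {n} → Automorphism n → Automorphism n → Set
_≈A_ {n} σ τ = ∀ (u : Vertex n) → proj₁ σ u ≈V proj₁ τ u

AutHasOrderTwo : ℕ → Set
AutHasOrderTwo n =
  Σ (Automorphism n) λ σ → Σ (Automorphism n) λ τ →
    ¬ (σ ≈A τ) × (∀ (ρ : Automorphism n) → ρ ≈A σ ⊎ ρ ≈A τ)

module Submission where

-- The proper divisors of p ^ a are the p ^ i with 0 < i < a, and p ^ i, p ^ j are adjacent iff
-- i ≠ j and a ≤ i + j, so Υ is a threshold graph.  Let P = ⌊(a - 1)/2⌋ and let rank i be the
-- degree of p ^ i, namely i for i ≤ P and i - 1 for i > P.  Some third vertex is adjacent to v
-- but not to u exactly when rank u < rank v; this relation is invariant under automorphisms, and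
-- since the ranks fill the interval [1, a - 2], every automorphism preserves ranks.  The rank is
-- injective except on the twins p ^ P and p ^ (P + 1), which have the same neighbours, so the
-- automorphisms are the identity and the transposition of the twins.

open import Defs
open import Data.Nat
open import Data.Nat.Properties
open import Data.Nat.Divisibility
open import Data.Nat.Primality using (Prime; prime⇒nonZero; prime⇒nonTrivial; prime⇒irreducible)
open import Data.Nat.Coprimality using (Coprime; coprime-divisor)
open import Data.Product using (Σ; ∃-syntax; _×_; _,_; proj₁; proj₂)
open import Data.Sum using (_⊎_; inj₁; inj₂)
open import Relation.Nullary using (¬_; yes; no; contradiction)
open import Relation.Binary.PropositionalEquality
open import Relation.Binary.Definitions using (tri<; tri≈; tri>)
open import Function.Base using (id; _∘_)
open import Function.Bundles using (_⇔_; mk⇔; Equivalence)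

private
  variable
    a d i j k m n P : ℕ

module PrimePower {p : ℕ} (p-prime : Prime p) where

  instance
    p≢0 : NonZero p
    p≢0 = prime⇒nonZero p-prime

  1<p : 1 < p
  1<p = nonTrivial⇒n>1 p {{prime⇒nonTrivial p-prime}}

  ^-monoʳ-∣ : m ≤ n → p ^ m ∣ p ^ n
  ^-monoʳ-∣ {m} m≤n with m≤n⇒∃[o]m+o≡n m≤n
  ... | o , refl = divides (p ^ o) (trans (^-distribˡ-+-* p m o) (*-comm (p ^ m) (p ^ o)))

  ^-cancelʳ-∣ : p ^ m ∣ p ^ n → m ≤ n
  ^-cancelʳ-∣ {n = n} p^m∣p^n =
    ≮⇒≥ λ n<m → <⇒≱ (^-monoʳ-< p 1<p n<m) (∣⇒≤ {{m^n≢0 p n}} p^m∣p^n)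

  ^-injectiveʳ : p ^ m ≡ p ^ n → m ≡ n
  ^-injectiveʳ eq = ≤-antisym (^-cancelʳ-∣ (∣-reflexive eq)) (^-cancelʳ-∣ (∣-reflexive (sym eq)))

  ∤⇒coprime : ¬ p ∣ d → Coprime d p
  ∤⇒coprime p∤d (e∣d , e∣p) with prime⇒irreducible p-prime e∣p
  ... | inj₁ e≡1 = e≡1
  ... | inj₂ refl = contradiction e∣d p∤d

  ∣p^n⇒≡p^m : ∀ n → d ∣ p ^ n → ∃[ m ] m ≤ n × d ≡ p ^ m
  ∣p^n⇒≡p^m zero d∣1 = 0 , z≤n , ∣1⇒≡1 d∣1
  ∣p^n⇒≡p^m {d} (suc n) d∣p^[1+n] with p ∣? d
  ... | yes (divides q refl) =
    let m , m≤n , q≡p^m = ∣p^n⇒≡p^m n (*-cancelˡ-∣ p (subst (_∣ p ^ suc n) (*-comm q p) d∣p^[1+n]))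
    in suc m , s≤s m≤n , trans (*-comm q p) (cong (p *_) q≡p^m)
  ... | no p∤d =
    let m , m≤n , d≡p^m = ∣p^n⇒≡p^m n (coprime-divisor (∤⇒coprime p∤d) d∣p^[1+n])
    in m , m≤n⇒m≤1+n m≤n , d≡p^m

transpose : ℕ → ℕ → ℕ → ℕ
transpose x y i with i ≟ x | i ≟ y
... | yes _ | _     = y
... | no _  | yes _ = x
... | no _  | no _  = i

module _ {x y : ℕ} where

  transpose-x : transpose x y x ≡ y
  transpose-x with x ≟ x
  ... | yes _ = refl
  ... | no x≢x = contradiction refl x≢x

  transpose-y : transpose x y y ≡ x
  transpose-y with y ≟ x | y ≟ y
  ... | yes y≡x | _ = y≡x
  ... | no _ | yes _ = refl
  ... | no _ | no y≢y = contradiction refl y≢y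

  transpose-involutive : ∀ i → transpose x y (transpose x y i) ≡ i
  transpose-involutive i with i ≟ x | i ≟ y
  ... | yes refl | _ = transpose-y
  ... | no _ | yes refl = transpose-x
  ... | no i≢x | no i≢y with i ≟ x | i ≟ y
  ...   | yes i≡x | _ = contradiction i≡x i≢x
  ...   | no _ | yes i≡y = contradiction i≡y i≢y
  ...   | no _ | no _ = refl

  transpose-injective : transpose x y i ≡ transpose x y j → i ≡ j
  transpose-injective {i} {j} eq = begin
    i                                      ≡⟨ transpose-involutive i ⟨
    transpose x y (transpose x y i)        ≡⟨ cong (transpose x y) eq ⟩
    transpose x y (transpose x y j)        ≡⟨ transpose-involutive j ⟩
    j                                      ∎
    where open ≡-Reasoning

  transpose-invariant : ∀ {A : Set} (f : ℕ → A) → f x ≡ f y → ∀ i → f (transpose x y i) ≡ f i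
  transpose-invariant f fx≡fy i with i ≟ x | i ≟ y
  ... | yes refl | _ = sym fx≡fy
  ... | no _ | yes refl = fx≡fy
  ... | no _ | no _ = refl

  transpose-preserves : ∀ (Q : ℕ → Set) → Q x → Q y → Q i → Q (transpose x y i)
  transpose-preserves {i} Q Qx Qy Qi with i ≟ x | i ≟ y
  ... | yes _ | _ = Qy
  ... | no _ | yes _ = Qx
  ... | no _ | no _ = Qi

module _ {X : Set} (ρ : X → ℕ) {lo hi : ℕ}
         (bounded : ∀ x → lo ≤ ρ x × ρ x ≤ hi)
         (onto : ∀ {m} → lo ≤ m → m ≤ hi → ∃[ x ] ρ x ≡ m) where

  private
    predecessor : ∀ {x d} → ρ x ≡ lo + suc d → ∃[ y ] suc (ρ y) ≡ ρ x
    predecessor {x} {d} ρx≡lo+1+d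
      with onto (m≤m+n lo d)
                (≤-trans (+-monoʳ-≤ lo (n≤1+n d)) (subst (_≤ hi) ρx≡lo+1+d (proj₂ (bounded x))))
    ... | y , ρy≡lo+d = y , trans (cong suc ρy≡lo+d) (sym (trans ρx≡lo+1+d (+-suc lo d)))

    successor : ∀ {x d} → ρ x + suc d ≡ hi → ∃[ y ] ρ y ≡ suc (ρ x)
    successor {x} {d} ρx+1+d≡hi =
      onto (≤-trans (proj₁ (bounded x)) (n≤1+n (ρ x)))
           (subst (suc (ρ x) ≤_) (trans (sym (+-suc (ρ x) d)) ρx+1+d≡hi) (s≤s (m≤m+n (ρ x) d)))

  strictMono⇒ρ-invariant : (g : X → X) → (∀ {x y} → ρ x < ρ y → ρ (g x) < ρ (g y)) →
                           ∀ x → ρ (g x) ≡ ρ x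
  strictMono⇒ρ-invariant g mono x =
    ≤-antisym (below-top (hi ∸ ρ x) x (m+[n∸m]≡n (proj₂ (bounded x))))
              (above-bottom (ρ x ∸ lo) x (sym (m+[n∸m]≡n (proj₁ (bounded x)))))
    where
      open ≤-Reasoning

      above-bottom : ∀ d x → ρ x ≡ lo + d → ρ x ≤ ρ (g x)
      above-bottom zero x ρx≡lo+0 =
        ≤-trans (≤-reflexive (trans ρx≡lo+0 (+-identityʳ lo))) (proj₁ (bounded (g x)))
      above-bottom (suc d) x ρx≡lo+1+d with predecessor ρx≡lo+1+d
      ... | y , 1+ρy≡ρx = begin
        ρ x              ≡⟨ 1+ρy≡ρx ⟨
        suc (ρ y)        ≤⟨ s≤s (above-bottom d y ρy≡lo+d) ⟩
        suc (ρ (g y))    ≤⟨ mono (subst (ρ y <_) 1+ρy≡ρx ≤-refl) ⟩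
        ρ (g x)          ∎
        where
          ρy≡lo+d : ρ y ≡ lo + d
          ρy≡lo+d = suc-injective (trans 1+ρy≡ρx (trans ρx≡lo+1+d (+-suc lo d)))

      below-top : ∀ d x → ρ x + d ≡ hi → ρ (g x) ≤ ρ x
      below-top zero x ρx+0≡hi =
        ≤-trans (proj₂ (bounded (g x))) (≤-reflexive (trans (sym ρx+0≡hi) (+-identityʳ (ρ x))))
      below-top (suc d) x ρx+1+d≡hi with successor ρx+1+d≡hi
      ... | y , ρy≡1+ρx = s≤s⁻¹ (begin
        suc (ρ (g x))    ≤⟨ mono (subst (ρ x <_) (sym ρy≡1+ρx) ≤-refl) ⟩
        ρ (g y)          ≤⟨ below-top d y (trans (cong (_+ d) ρy≡1+ρx) (trans (sym (+-suc (ρ x) d)) ρx+1+d≡hi)) ⟩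
        ρ y              ≡⟨ ρy≡1+ρx ⟩
        suc (ρ x)        ∎)

Dominated : (n : ℕ) → Vertex n → Vertex n → Set
Dominated n u v = Σ (Vertex n) λ w → ¬ w ≈V u × Adjacent n v w × ¬ Adjacent n u w

module _ {n : ℕ} {f : Vertex n → Vertex n} (aut : IsAutomorphism n f) where
  open IsAutomorphism aut

  automorphism-preserves-Dominated : ∀ {u v} → Dominated n u v → Dominated n (f u) (f v)
  automorphism-preserves-Dominated {u} {v} (w , w≉u , v~w , u≁w) =
    f w , w≉u ∘ proj₁ bijective , Equivalence.to (adjacency v w) v~w , u≁w ∘ Equivalence.from (adjacency u w)

Adjacent-resp-≈V : ∀ {n u u′ v v′} → u ≈V u′ → v ≈V v′ → Adjacent n u v → Adjacent n u′ v′
Adjacent-resp-≈V {n} u≈u′ v≈v′ (u≉v , n∣uv) =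
  (λ u′≈v′ → u≉v (trans u≈u′ (trans u′≈v′ (sym v≈v′)))) ,
  subst (n ∣_) (cong₂ _*_ u≈u′ v≈v′) n∣uv

identity : ∀ n → Automorphism n
identity n = id , record
  { cong      = id
  ; bijective = id , λ v → v , id
  ; adjacency = λ _ _ → mk⇔ id id
  }

ProperExponent : ℕ → ℕ → Set
ProperExponent a i = 1 ≤ i × i < a

Adjacentᴱ : ℕ → ℕ → ℕ → Set
Adjacentᴱ a i j = i ≢ j × a ≤ i + j

Dominatedᴱ : ℕ → ℕ → ℕ → Set
Dominatedᴱ a i j = Σ ℕ λ k → ProperExponent a k × k ≢ i × Adjacentᴱ a j k × ¬ Adjacentᴱ a i k

dominatedᴱ-by : ProperExponent a k → a ≤ j + k → i + k < a → k ≢ i → k ≢ j → Dominatedᴱ a i j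
dominatedᴱ-by hk a≤j+k i+k<a k≢i k≢j =
  _ , hk , k≢i , (≢-sym k≢j , a≤j+k) , λ (_ , a≤i+k) → <⇒≱ i+k<a a≤i+k

complement : j < a → ∃[ k ] 1 ≤ k × j + k ≡ a
complement {j} j<a with m≤n⇒∃[o]m+o≡n j<a
... | o , 1+j+o≡a = suc o , s≤s z≤n , trans (+-suc j o) 1+j+o≡a

dominated-by-complement : i < j → 1 ≤ k → j + k ≡ a → k ≢ i → k ≢ j → Dominatedᴱ a i j
dominated-by-complement {i} {j} {k} i<j 1≤k j+k≡a =
  dominatedᴱ-by (1≤k , subst (k <_) j+k≡a (m<n+m k (≤-trans (s≤s z≤n) i<j)))
    (≤-reflexive (sym j+k≡a)) (subst (i + k <_) j+k≡a (+-monoˡ-< k i<j))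

-- The complement k = a - j separates i from j unless k ∈ {i, j}, and then k + 1 does.
dominated-apart : suc i < j → j < a → Dominatedᴱ a i j
dominated-apart {i} {j} 1+i<j j<a with complement j<a
... | k , 1≤k , j+k≡a with k ≟ j | k ≟ i
...   | yes refl | _ =
  dominatedᴱ-by (s≤s z≤n , subst (suc j <_) j+k≡a (subst (_< j + j) (+-comm j 1) (+-monoʳ-< j 1<j)))
    (subst (_≤ j + suc j) j+k≡a (+-monoʳ-≤ j (n≤1+n j)))
    (subst (i + suc j <_) j+k≡a (subst (_< j + j) (sym (+-suc i j)) (+-monoˡ-< j 1+i<j)))
    (≢-sym (<⇒≢ (m<n⇒m<1+n (<-trans (n<1+n i) 1+i<j)))) 1+n≢n
  where
    1<j : 1 < j
    1<j = ≤-trans (s≤s (s≤s z≤n)) 1+i<j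
...   | no _ | yes refl =
  dominatedᴱ-by (s≤s z≤n , subst (suc i <_) j+k≡a (<-≤-trans 1+i<j (m≤m+n j i)))
    (subst (_≤ j + suc i) j+k≡a (+-monoʳ-≤ j (n≤1+n i)))
    (subst (i + suc i <_) j+k≡a (subst (_< j + i) (+-comm (suc i) i) (+-monoˡ-< i 1+i<j)))
    1+n≢n (<⇒≢ 1+i<j)
...   | no k≢j | no k≢i = dominated-by-complement (<-trans (n<1+n i) 1+i<j) 1≤k j+k≡a k≢i k≢j

-- P = ⌊(a - 1)/2⌋, so that p ^ P and p ^ (P + 1) are the twin vertices of Υ over p ^ a.
record IsMiddle (a P : ℕ) : Set where
  constructor is-middle
  field
    lower : P + P < a
    upper : a ≤ 2 + (P + P)

suc+suc : ∀ m → suc m + suc m ≡ 2 + (m + m)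
suc+suc m = cong suc (+-suc m m)

middle-exists : ∀ a → 1 ≤ a → ∃[ P ] IsMiddle a P
middle-exists 1 _ = 0 , is-middle ≤-refl (s≤s z≤n)
middle-exists 2 _ = 0 , is-middle (s≤s z≤n) ≤-refl
middle-exists (suc (suc (suc b))) _ with middle-exists (suc b) (s≤s z≤n)
... | P , is-middle 2P<1+b 1+b≤2+2P =
  suc P , is-middle (subst (_< 3 + b) (sym (suc+suc P)) (s≤s (s≤s 2P<1+b)))
                  (subst (3 + b ≤_) (cong (2 +_) (sym (suc+suc P))) (s≤s (s≤s 1+b≤2+2P)))

middle-≤ : i + i < a → a ≤ 2 + (j + j) → i ≤ j
middle-≤ {i} {a} {j} 2i<a a≤2+2j = ≮⇒≥ λ j<i → <⇒≱ 2i<a (begin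
  a                ≤⟨ a≤2+2j ⟩
  2 + (j + j)      ≡⟨ suc+suc j ⟨
  suc j + suc j    ≤⟨ +-mono-≤ j<i j<i ⟩
  i + i            ∎)
  where open ≤-Reasoning

middle-unique : IsMiddle a i → IsMiddle a j → i ≡ j
middle-unique (is-middle 2i<a a≤2+2i) (is-middle 2j<a a≤2+2j) =
  ≤-antisym (middle-≤ 2i<a a≤2+2j) (middle-≤ 2j<a a≤2+2i)

odd-middle : IsMiddle (suc (i + i)) i
odd-middle = is-middle (n<1+n _) (n≤1+n _)

even-middle : IsMiddle (2 + (i + i)) i
even-middle = is-middle (m<n⇒m<1+n (n<1+n _)) ≤-refl

middle-positive : 3 ≤ a → IsMiddle a P → 1 ≤ P
middle-positive {P = zero} 3≤a (is-middle _ a≤2) = contradiction a≤2 (<⇒≱ 3≤a)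
middle-positive {P = suc _} _ _ = s≤s z≤n

-- For j = i + 1 the complement fails only if a ∈ {2i + 1, 2i + 2}, that is, only if i is the middle.
dominated-consecutive : IsMiddle a P → i ≢ P → suc i < a → Dominatedᴱ a i (suc i)
dominated-consecutive {a} {P} {i} middle i≢P 1+i<a with complement 1+i<a
... | k , 1≤k , 1+i+k≡a with k ≟ suc i | k ≟ i
...   | yes refl | _ =
  contradiction (middle-unique (subst (λ x → IsMiddle x i) (trans (sym (suc+suc i)) 1+i+k≡a) even-middle) middle)
                i≢P
...   | no _ | yes refl =
  contradiction (middle-unique (subst (λ x → IsMiddle x i) 1+i+k≡a odd-middle) middle) i≢P
...   | no k≢1+i | no k≢i = dominated-by-complement (n<1+n i) 1≤k 1+i+k≡a k≢i k≢1+i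

module Threshold {a P : ℕ} (middle : IsMiddle a P) (1≤P : 1 ≤ P) where

  2P<a : P + P < a
  2P<a = IsMiddle.lower middle

  1+P<a : suc P < a
  1+P<a = ≤-<-trans (+-monoˡ-≤ P 1≤P) 2P<a

  -- The degree of p ^ i in Υ over p ^ a.
  rank : ℕ → ℕ
  rank i with i ≤? P
  ... | yes _ = i
  ... | no _  = pred i

  rank-≤ : i ≤ P → rank i ≡ i
  rank-≤ {i} i≤P with i ≤? P
  ... | yes _ = refl
  ... | no i≰P = contradiction i≤P i≰P

  rank-> : P < i → suc (rank i) ≡ i
  rank-> {zero} ()
  rank-> {suc i} P<1+i with suc i ≤? P
  ... | yes 1+i≤P = contradiction 1+i≤P (<⇒≱ P<1+i)
  ... | no _ = refl

  data RankView (i : ℕ) : Set where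
    low  : i ≤ P → rank i ≡ i → RankView i
    high : P < i → suc (rank i) ≡ i → RankView i

  rank-view : ∀ i → RankView i
  rank-view i with i ≤? P
  ... | yes i≤P = low i≤P (rank-≤ i≤P)
  ... | no i≰P = high (≰⇒> i≰P) (rank-> (≰⇒> i≰P))

  rank-twins : rank P ≡ rank (suc P)
  rank-twins = trans (rank-≤ ≤-refl) (suc-injective (sym (rank-> ≤-refl)))

  P≤rank : P < i → P ≤ rank i
  P≤rank P<i = s≤s⁻¹ (subst (P <_) (sym (rank-> P<i)) P<i)

  rank-low≡high⇒P : i ≤ P → P < j → rank i ≡ rank j → i ≡ P
  rank-low≡high⇒P i≤P P<j eq = ≤-antisym i≤P (subst (P ≤_) (trans (sym eq) (rank-≤ i≤P)) (P≤rank P<j))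

  rank-injective : i ≢ P → j ≢ P → rank i ≡ rank j → i ≡ j
  rank-injective {i} {j} i≢P j≢P eq with rank-view i | rank-view j
  ... | low _ ri≡i  | low _ rj≡j  = trans (sym ri≡i) (trans eq rj≡j)
  ... | high _ ri≡i | high _ rj≡j = trans (sym ri≡i) (trans (cong suc eq) rj≡j)
  ... | low i≤P _   | high P<j _  = contradiction (rank-low≡high⇒P i≤P P<j eq) i≢P
  ... | high P<i _  | low j≤P _   = contradiction (rank-low≡high⇒P j≤P P<i (sym eq)) j≢P

  rank<⇒< : rank i < rank j → i < j
  rank<⇒< {i} {j} ri<rj with rank-view i | rank-view j
  ... | low _ ri≡i  | low _ rj≡j  = subst₂ _<_ ri≡i rj≡j ri<rj
  ... | low _ ri≡i  | high _ rj≡j = subst₂ _<_ ri≡i rj≡j (m<n⇒m<1+n ri<rj)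
  ... | high _ ri≡i | high _ rj≡j = subst₂ _<_ ri≡i rj≡j (s≤s ri<rj)
  ... | high P<i _  | low j≤P rj≡j =
    contradiction ri<rj (≤⇒≯ (≤-trans (≤-reflexive rj≡j) (≤-trans j≤P (P≤rank P<i))))

  adjacent⇔rank-< : i < j → (a ≤ i + j ⇔ a ≤ suc (rank i + rank j))
  adjacent⇔rank-< {i} {j} i<j with rank-view i | rank-view j
  ... | low _ ri≡i | low j≤P rj≡j rewrite ri≡i | rj≡j =
    mk⇔ (λ a≤i+j → contradiction (m≤n⇒m≤1+n a≤i+j) (<⇒≱ 1+i+j<a))
        (λ a≤1+i+j → contradiction a≤1+i+j (<⇒≱ 1+i+j<a))
    where
      1+i+j<a : suc (i + j) < a
      1+i+j<a = ≤-<-trans (+-mono-≤ (≤-trans i<j j≤P) j≤P) 2P<a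
  ... | low _ ri≡i | high _ rj≡j = mk⇔ (subst (a ≤_) i+j≡) (subst (a ≤_) (sym i+j≡))
    where
      i+j≡ : i + j ≡ suc (rank i + rank j)
      i+j≡ = trans (cong₂ _+_ (sym ri≡i) (sym rj≡j)) (+-suc (rank i) (rank j))
  ... | high P<i ri≡i | high _ rj≡j = mk⇔ (λ _ → a≤) (λ a≤1+ri+rj → ≤-trans a≤1+ri+rj ≤i+j)
    where
      P<rj : P < rank j
      P<rj = ≤-<-trans (P≤rank P<i) (s≤s⁻¹ (subst₂ _<_ (sym ri≡i) (sym rj≡j) i<j))
      a≤ : a ≤ suc (rank i + rank j)
      a≤ = begin
        a                        ≤⟨ IsMiddle.upper middle ⟩
        2 + (P + P)              ≡⟨ cong suc (+-suc P P) ⟨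
        suc (P + suc P)          ≤⟨ s≤s (+-mono-≤ (P≤rank P<i) P<rj) ⟩
        suc (rank i + rank j)    ∎
        where open ≤-Reasoning
      ≤i+j : suc (rank i + rank j) ≤ i + j
      ≤i+j = subst₂ (λ x y → suc (rank i + rank j) ≤ x + y) ri≡i rj≡j
               (s≤s (+-monoʳ-≤ (rank i) (n≤1+n (rank j))))
  ... | high P<i _ | low j≤P _ = contradiction (<-trans i<j (≤-<-trans j≤P P<i)) (<-irrefl refl)

  adjacent⇔rank : i ≢ j → (a ≤ i + j ⇔ a ≤ suc (rank i + rank j))
  adjacent⇔rank {i} {j} i≢j with <-cmp i j
  ... | tri< i<j _ _ = adjacent⇔rank-< i<j
  ... | tri≈ _ i≡j _ = contradiction i≡j i≢j
  ... | tri> _ _ j<i =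
    subst₂ (λ x y → a ≤ x ⇔ a ≤ suc y) (+-comm j i) (+-comm (rank j) (rank i)) (adjacent⇔rank-< j<i)

  dominated⇒rank< : Dominatedᴱ a i j → rank i < rank j
  dominated⇒rank< {i} {j} (k , _ , k≢i , (j≢k , a≤j+k) , ¬ik) =
    +-cancelʳ-< (rank k) (rank i) (rank j) (s≤s⁻¹ (≤-trans 1+ri+rk<a a≤1+rj+rk))
    where
      1+ri+rk<a : suc (rank i + rank k) < a
      1+ri+rk<a = ≰⇒> λ a≤ → ¬ik (≢-sym k≢i , Equivalence.from (adjacent⇔rank (≢-sym k≢i)) a≤)
      a≤1+rj+rk : a ≤ suc (rank j + rank k)
      a≤1+rj+rk = Equivalence.to (adjacent⇔rank j≢k) a≤j+k

  rank<⇒dominated : j < a → rank i < rank j → Dominatedᴱ a i j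
  rank<⇒dominated {j} {i} j<a ri<rj with m≤n⇒m<n∨m≡n (rank<⇒< ri<rj)
  ... | inj₁ 1+i<j = dominated-apart 1+i<j j<a
  ... | inj₂ refl = dominated-consecutive middle i≢P j<a
    where
      i≢P : i ≢ P
      i≢P refl = <-irrefl rank-twins ri<rj

  ≤∸2⇒1+<a : m ≤ a ∸ 2 → suc m < a
  ≤∸2⇒1+<a m≤a∸2 =
    ≤-trans (s≤s (s≤s m≤a∸2)) (≤-reflexive (m+[n∸m]≡n (≤-trans (s≤s (s≤s z≤n)) 1+P<a)))

  rank-bounds : ProperExponent a i → 1 ≤ rank i × rank i ≤ a ∸ 2
  rank-bounds {i} (1≤i , i<a) with rank-view i
  ... | low i≤P ri≡i =
    subst (1 ≤_) (sym ri≡i) 1≤i ,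
    ∸-monoˡ-≤ 2 (subst (λ x → suc x < a) (sym ri≡i) (≤-<-trans (s≤s i≤P) 1+P<a))
  ... | high P<i 1+ri≡i = ≤-trans 1≤P (P≤rank P<i) , ∸-monoˡ-≤ 2 (subst (_< a) (sym 1+ri≡i) i<a)

  rank-surjective : 1 ≤ m → m ≤ a ∸ 2 → ∃[ i ] ProperExponent a i × rank i ≡ m
  rank-surjective {m} 1≤m m≤a∸2 with m ≤? P
  ... | yes m≤P = m , (1≤m , <-trans (n<1+n m) (≤∸2⇒1+<a m≤a∸2)) , rank-≤ m≤P
  ... | no m≰P = suc m , (s≤s z≤n , ≤∸2⇒1+<a m≤a∸2) , suc-injective (rank-> (m<n⇒m<1+n (≰⇒> m≰P)))

  P-proper : ProperExponent a P
  P-proper = 1≤P , <-trans (n<1+n P) 1+P<a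

  swap : ℕ → ℕ
  swap = transpose P (suc P)

  rank-swap : ∀ i → rank (swap i) ≡ rank i
  rank-swap = transpose-invariant rank rank-twins

  swap-proper : ProperExponent a i → ProperExponent a (swap i)
  swap-proper = transpose-preserves (ProperExponent a) P-proper (s≤s z≤n , 1+P<a)

  swap-adjacent : Adjacentᴱ a i j → Adjacentᴱ a (swap i) (swap j)
  swap-adjacent {i} {j} (i≢j , a≤i+j) = si≢sj , Equivalence.from (adjacent⇔rank si≢sj) a≤1+rsi+rsj
    where
      si≢sj : swap i ≢ swap j
      si≢sj = i≢j ∘ transpose-injective
      a≤1+rsi+rsj : a ≤ suc (rank (swap i) + rank (swap j))
      a≤1+rsi+rsj = subst₂ (λ x y → a ≤ suc (x + y)) (sym (rank-swap i)) (sym (rank-swap j))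
                      (Equivalence.to (adjacent⇔rank i≢j) a≤i+j)

module PrimePowerGraph {p : ℕ} (p-prime : Prime p) (a : ℕ) where
  open PrimePower p-prime

  private
    V : Set
    V = Vertex (p ^ a)

  exponent-spec : (v : V) → ∃[ i ] ProperExponent a i × proj₁ v ≡ p ^ i
  exponent-spec (d , 1<d , d<p^a , d∣p^a) with ∣p^n⇒≡p^m a d∣p^a
  ... | i , i≤a , refl = i , (n≢0⇒n>0 i≢0 , ≤∧≢⇒< i≤a i≢a) , refl
    where
      i≢0 : i ≢ 0
      i≢0 refl = <-irrefl refl 1<d
      i≢a : i ≢ a
      i≢a refl = <-irrefl refl d<p^a

  exponent : V → ℕ
  exponent v = proj₁ (exponent-spec v)

  exponent-proper : ∀ v → ProperExponent a (exponent v)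
  exponent-proper v = proj₁ (proj₂ (exponent-spec v))

  ≡p^exponent : ∀ v → proj₁ v ≡ p ^ exponent v
  ≡p^exponent v = proj₂ (proj₂ (exponent-spec v))

  vertex : ProperExponent a i → V
  vertex {i} (1≤i , i<a) = p ^ i , ^-monoʳ-< p 1<p 1≤i , ^-monoʳ-< p 1<p i<a , ^-monoʳ-∣ (<⇒≤ i<a)

  exponent-vertex : (h : ProperExponent a i) → exponent (vertex h) ≡ i
  exponent-vertex h = ^-injectiveʳ (sym (≡p^exponent (vertex h)))

  ≈V⇒≡exponent : ∀ {u v} → u ≈V v → exponent u ≡ exponent v
  ≈V⇒≡exponent {u} {v} u≈v = ^-injectiveʳ (trans (sym (≡p^exponent u)) (trans u≈v (≡p^exponent v)))

  ≡exponent⇒≈V : ∀ {u v} → exponent u ≡ exponent v → u ≈V v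
  ≡exponent⇒≈V {u} {v} eq = trans (≡p^exponent u) (trans (cong (p ^_) eq) (sym (≡p^exponent v)))

  adjacent⇔ : ∀ {u v} → Adjacent (p ^ a) u v ⇔ Adjacentᴱ a (exponent u) (exponent v)
  adjacent⇔ {u} {v} = mk⇔
    (λ (u≉v , p^a∣uv) → u≉v ∘ ≡exponent⇒≈V , ^-cancelʳ-∣ (subst (p ^ a ∣_) uv≡ p^a∣uv))
    (λ (eu≢ev , a≤eu+ev) → eu≢ev ∘ ≈V⇒≡exponent , subst (p ^ a ∣_) (sym uv≡) (^-monoʳ-∣ a≤eu+ev))
    where
      uv≡ : proj₁ u * proj₁ v ≡ p ^ (exponent u + exponent v)
      uv≡ = trans (cong₂ _*_ (≡p^exponent u) (≡p^exponent v)) (sym (^-distribˡ-+-* p (exponent u) (exponent v)))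

  Dominated⇔ : ∀ {u v} → Dominated (p ^ a) u v ⇔ Dominatedᴱ a (exponent u) (exponent v)
  Dominated⇔ {u} {v} = mk⇔
    (λ (w , w≉u , v~w , u≁w) →
      exponent w , exponent-proper w , w≉u ∘ ≡exponent⇒≈V ,
      Equivalence.to adjacent⇔ v~w , u≁w ∘ Equivalence.from adjacent⇔)
    (λ (k , hk , k≢eu , ev~k , eu≁k) →
      vertex hk , k≢eu ∘ trans (sym (exponent-vertex hk)) ∘ ≈V⇒≡exponent ,
      Equivalence.from adjacent⇔ (subst (Adjacentᴱ a (exponent v)) (sym (exponent-vertex hk)) ev~k) ,
      eu≁k ∘ subst (Adjacentᴱ a (exponent u)) (exponent-vertex hk) ∘ Equivalence.to adjacent⇔)

module Automorphisms {p : ℕ} (p-prime : Prime p) {a P : ℕ} (middle : IsMiddle a P) (1≤P : 1 ≤ P) where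
  open PrimePowerGraph p-prime a
  open Threshold middle 1≤P

  private
    V : Set
    V = Vertex (p ^ a)

  ρ : V → ℕ
  ρ v = rank (exponent v)

  automorphism-preserves-ρ : ∀ {f} → IsAutomorphism (p ^ a) f → ∀ v → ρ (f v) ≡ ρ v
  automorphism-preserves-ρ {f} aut = strictMono⇒ρ-invariant ρ (rank-bounds ∘ exponent-proper) onto f mono
    where
      onto : ∀ {m} → 1 ≤ m → m ≤ a ∸ 2 → ∃[ v ] ρ v ≡ m
      onto 1≤m m≤a∸2 with rank-surjective 1≤m m≤a∸2
      ... | i , hi , ri≡m = vertex hi , trans (cong rank (exponent-vertex hi)) ri≡m
      mono : ∀ {u v} → ρ u < ρ v → ρ (f u) < ρ (f v)
      mono {u} {v} ρu<ρv =
        dominated⇒rank< (Equivalence.to Dominated⇔ (automorphism-preserves-Dominated aut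
          (Equivalence.from (Dominated⇔ {u} {v}) (rank<⇒dominated (proj₂ (exponent-proper v)) ρu<ρv))))

  twin : V
  twin = vertex P-proper

  exponent-twin : exponent twin ≡ P
  exponent-twin = exponent-vertex P-proper

  τ : V → V
  τ v = vertex (swap-proper (exponent-proper v))

  exponent-τ : ∀ v → exponent (τ v) ≡ swap (exponent v)
  exponent-τ v = exponent-vertex (swap-proper (exponent-proper v))

  ρ-τ : ∀ v → ρ (τ v) ≡ ρ v
  ρ-τ v = trans (cong rank (exponent-τ v)) (rank-swap (exponent v))

  τ-cong : ∀ {u v} → u ≈V v → τ u ≈V τ v
  τ-cong {u} {v} u≈v =
    ≡exponent⇒≈V (trans (exponent-τ u) (trans (cong swap (≈V⇒≡exponent u≈v)) (sym (exponent-τ v))))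

  τ-injective : ∀ {u v} → τ u ≈V τ v → u ≈V v
  τ-injective {u} {v} τu≈τv =
    ≡exponent⇒≈V (transpose-injective (trans (sym (exponent-τ u)) (trans (≈V⇒≡exponent τu≈τv) (exponent-τ v))))

  τ-involutive : ∀ v → τ (τ v) ≈V v
  τ-involutive v = ≡exponent⇒≈V (begin
    exponent (τ (τ v))        ≡⟨ exponent-τ (τ v) ⟩
    swap (exponent (τ v))     ≡⟨ cong swap (exponent-τ v) ⟩
    swap (swap (exponent v))  ≡⟨ transpose-involutive (exponent v) ⟩
    exponent v                ∎)
    where open ≡-Reasoning

  τ-adjacent : ∀ {u v} → Adjacent (p ^ a) u v → Adjacent (p ^ a) (τ u) (τ v)
  τ-adjacent {u} {v} u~v = Equivalence.from adjacent⇔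
    (subst₂ (Adjacentᴱ a) (sym (exponent-τ u)) (sym (exponent-τ v)) (swap-adjacent (Equivalence.to adjacent⇔ u~v)))

  τ-reflects-adjacent : ∀ {u v} → Adjacent (p ^ a) (τ u) (τ v) → Adjacent (p ^ a) u v
  τ-reflects-adjacent {u} {v} =
    Adjacent-resp-≈V {u = τ (τ u)} {u} {τ (τ v)} {v} (τ-involutive u) (τ-involutive v) ∘ τ-adjacent

  τ-automorphism : Automorphism (p ^ a)
  τ-automorphism = τ , record
    { cong      = τ-cong
    ; bijective = τ-injective , λ v → τ v , λ {z} z≈τv → trans (τ-cong {z} z≈τv) (τ-involutive v)
    ; adjacency = λ u v → mk⇔ τ-adjacent (τ-reflects-adjacent {u} {v})
    }

  identity≉τ : ¬ (identity (p ^ a) ≈A τ-automorphism)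
  identity≉τ id≈τ = 1+n≢n (sym (begin
    P                         ≡⟨ exponent-twin ⟨
    exponent twin             ≡⟨ ≈V⇒≡exponent (id≈τ twin) ⟩
    exponent (τ twin)         ≡⟨ exponent-τ twin ⟩
    swap (exponent twin)      ≡⟨ cong swap exponent-twin ⟩
    swap P                    ≡⟨ transpose-x {P} {suc P} ⟩
    suc P                     ∎))
    where open ≡-Reasoning

  fixing-twin⇒≈id : (g : V → V) →
                    (∀ {u v} → u ≈V v → g u ≈V g v) → (∀ {u v} → g u ≈V g v → u ≈V v) →
                    (∀ v → ρ (g v) ≡ ρ v) → exponent (g twin) ≡ P → ∀ v → g v ≈V v
  fixing-twin⇒≈id g g-cong g-injective g-ρ g-twin v with exponent v ≟ P
  ... | yes ev≡P = ≡exponent⇒≈V (trans (≈V⇒≡exponent {g v} (g-cong v≈twin)) (trans g-twin (sym ev≡P)))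
    where
      v≈twin : v ≈V twin
      v≈twin = ≡exponent⇒≈V (trans ev≡P (sym exponent-twin))
  ... | no ev≢P = ≡exponent⇒≈V (rank-injective egv≢P ev≢P (g-ρ v))
    where
      egv≢P : exponent (g v) ≢ P
      egv≢P egv≡P =
        ev≢P (trans (≈V⇒≡exponent (g-injective (≡exponent⇒≈V (trans egv≡P (sym g-twin))))) exponent-twin)

  classification : (σ : Automorphism (p ^ a)) → σ ≈A identity (p ^ a) ⊎ σ ≈A τ-automorphism
  classification (f , aut) with exponent (f twin) ≟ P
  ... | yes ef≡P = inj₁ (fixing-twin⇒≈id f f-cong (proj₁ bijective) (automorphism-preserves-ρ aut) ef≡P)
    where open IsAutomorphism aut using (bijective) renaming (cong to f-cong)
  -- Otherwise f moves the twin to its partner, and τ ∘ f fixes it.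
  ... | no ef≢P = inj₂ λ v → trans (sym (τ-involutive (f v))) (τ-cong (τf≈id v))
    where
      open IsAutomorphism aut using (bijective) renaming (cong to f-cong)
      ef≡1+P : exponent (f twin) ≡ suc P
      ef≡1+P = rank-injective ef≢P 1+n≢n
                 (trans (automorphism-preserves-ρ aut twin) (trans (cong rank exponent-twin) rank-twins))
      τf≈id : ∀ v → τ (f v) ≈V v
      τf≈id = fixing-twin⇒≈id (τ ∘ f) (τ-cong ∘ f-cong) (proj₁ bijective ∘ τ-injective)
                (λ v → trans (ρ-τ (f v)) (automorphism-preserves-ρ aut v))
                (trans (exponent-τ (f twin)) (trans (cong swap ef≡1+P) (transpose-y {P} {suc P})))

  aut-has-order-two : AutHasOrderTwo (p ^ a)
  aut-has-order-two = identity (p ^ a) , τ-automorphism , identity≉τ , classification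

proposition4p1 : ∀ (p α : ℕ) → Prime p → 3 ≤ α → AutHasOrderTwo (p ^ α)
proposition4p1 p α p-prime 3≤α with middle-exists α (≤-trans (s≤s z≤n) 3≤α)
... | P , middle = Automorphisms.aut-has-order-two p-prime middle (middle-positive 3≤α middle)
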